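{- For every integer $k\geq 2$, $\mathrm{gp}^k(P_\infty\,\Box\, P_\infty)=(k-1)^2$.
   Context: $P_\infty\,\Box\,P_\infty$ is the infinite two-dimensional grid: vertex set $\mathbb{Z}^2$, with $(x,y)$ and $(x',y')$ adjacent iff they differ by exactly $1$ in exactly one coordinate and agree in the other. A geodesic of a graph is a shortest path between two of its vertices. For a graph $G$ and $k\ge2$, $\mathrm{gp}^k(G)$ denotes the largest cardinality of a set $S\subseteq V(G)$ such that no geodesic of $G$ contains $k$ or more vertices of $S$. -}

module Defs where

open import Data.Nat using (ℕ; zero; suc; _≤_; _∸_; _^_)
open import Data.Integer as ℤ using (ℤ; ∣_∣; _-_)
open import Data.Product using (_×_; Σ; _,_)
open import Data.Sum using (_⊎_)
open import Data.List using (List; []; _∷_; length)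
open import Data.List.Relation.Unary.All using (All)
open import Data.List.Relation.Unary.Unique.Propositional using (Unique)
open import Data.List.Membership.Propositional using (_∈_)
open import Relation.Binary.PropositionalEquality using (_≡_)
open import Relation.Nullary using (¬_)

V : Set
V = ℤ × ℤ

Adj : V → V → Set
Adj (x , y) (x' , y') =
  (x ≡ x' × ∣ y - y' ∣ ≡ 1) ⊎ (y ≡ y' × ∣ x - x' ∣ ≡ 1)

data Walk : V → V → Set where
  [_]    : (u : V) → Walk u u
  _∷⟨_⟩_ : (u : V) {w v : V} → Adj u w → Walk w v → Walk u v

len : {u v : V} → Walk u v → ℕ
len [ u ]          = 0
len (u ∷⟨ _ ⟩ p)   = suc (len p)

verts : {u v : V} → Walk u v → List V
verts [ u ]        = u ∷ []
verts (u ∷⟨ _ ⟩ p) = u ∷ verts p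

IsGeodesic : {u v : V} → Walk u v → Set
IsGeodesic {u} {v} p = (q : Walk u v) → len p ≤ len q

ContainsAtLeast : ℕ → (V → Set) → {u v : V} → Walk u v → Set
ContainsAtLeast k S p =
  Σ (List V) λ L → Unique L × All (λ x → S x × x ∈ verts p) L × k ≤ length L

IsGPk : ℕ → (V → Set) → Set
IsGPk k S = (u v : V) (p : Walk u v) → IsGeodesic p → ¬ ContainsAtLeast k S p

-- gp^k(G) = m : some k-gp set has exactly m elements, and no k-gp set
-- (possibly infinite) has more than m distinct elements.
GpkEquals : ℕ → ℕ → Set₁
GpkEquals k m =
  (Σ (List V) λ L → Unique L × length L ≡ m × IsGPk k (λ x → x ∈ L))
  × ((S : V → Set) → IsGPk k S → (L : List V) → Unique L → All S L → length L ≤ m)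

-- The ℓ¹ distance d is the graph distance of the grid, so a walk is a geodesic iff its length is the
-- distance of its endpoints, and along a geodesic each coordinate moves monotonically.
--
-- Lower bound: on a geodesic either x + y or x − y is strictly monotone, according as the two
-- coordinates move in the same or in opposite directions. On the rotated grid
-- {(a + b , a − b) : a , b < k − 1} each of these functions takes only k − 1 values, so no geodesic
-- meets it in k points.
--
-- Upper bound: any two points are comparable in the north-east or in the south-east order, and a
-- chain in either order lies on a single geodesic, so a k-general position set has no such chain of
-- k points. Labelling each point of the x-sorted set by the lengths of the longest NE and SE chains
-- starting at it gives distinct labels in [0 , k − 1)², hence at most (k − 1)² points
-- (Erdős–Szekeres).

module Submission where

open import Defs
open import Data.Nat using (ℕ; _≤_; _∸_; _^_)

open import Level using (0ℓ)
open import Function using (id; _∘_; flip)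
open import Data.Nat using (zero; suc; _+_; _*_; _<_; _⊔_; z≤n; s≤s)
import Data.Nat.Properties as ℕP
open import Data.Integer as ℤ using (ℤ; +_; ∣_∣; _-_; 1ℤ; -1ℤ)
import Data.Integer.Properties as ℤP
open import Data.Integer.Tactic.RingSolver using (solve-∀)
open import Data.Product using (_×_; Σ-syntax; _,_; proj₁; proj₂)
open import Data.Sum as Sum using (_⊎_; inj₁; inj₂)
open import Data.List using (List; []; _∷_; _++_; length; map; upTo; cartesianProduct; cartesianProductWith)
open import Data.List.Properties using (length-map; length-++; length-++-sucʳ; length-upTo)
open import Data.List.Relation.Unary.All as All using (All; []; _∷_)
open import Data.List.Relation.Unary.AllPairs as AllPairs using (AllPairs; []; _∷_)
open import Data.List.Relation.Unary.Any using (here; there)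
open import Data.List.Relation.Unary.Linked using (Linked; []; [-]; _∷_)
open import Data.List.Relation.Unary.Unique.Propositional using (Unique)
open import Data.List.Relation.Unary.Unique.Propositional.Properties using (cartesianProductWith⁺; upTo⁺)
open import Data.List.Membership.Propositional using (_∈_)
open import Data.List.Membership.Propositional.Properties
  using (∈-∃++; ∈-++⁻; ∈-++⁺ˡ; ∈-++⁺ʳ; ∈-map⁺; ∈-upTo⁺; ∈-cartesianProduct⁺; ∈-cartesianProductWith⁻)
open import Data.List.Relation.Binary.Sublist.Propositional using (_⊆_; []; _∷_; _∷ʳ_)
open import Data.List.Relation.Binary.Sublist.Propositional.Properties using (All-resp-⊆)
open import Data.List.Relation.Unary.Linked.Properties using (Linked⇒AllPairs)
open import Data.List.Relation.Binary.Permutation.Propositional using (↭-sym; ↭⇒↭ₛ)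
open import Data.List.Relation.Binary.Permutation.Propositional.Properties using (↭-length; All-resp-↭)
open import Relation.Binary.PropositionalEquality.Properties using (setoid)
open import Data.List.Relation.Binary.Permutation.Setoid.Properties (setoid V) using (Unique-resp-↭)
import Relation.Binary.Construct.On as On
open import Data.List.Sort (On.decTotalOrder ℤP.≤-decTotalOrder (λ (u : V) → proj₁ u))
  using (sort; sort-↭; sort-↗)
open import Relation.Binary.Core using (Rel)
open import Relation.Binary.Definitions using (Decidable; Reflexive; Transitive)
open import Relation.Binary.PropositionalEquality
open import Relation.Nullary using (yes; no; contradiction)
open import Relation.Nullary.Decidable using (_×-dec_)
open import Algebra.Properties.CommutativeSemigroup ℕP.+-commutativeSemigroup using (interchange)

private
  variable
    A B : Set
    a b c : ℤ
    u v w : V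

∣-∣-triangle : ∀ a b c → ∣ a - c ∣ ≤ ∣ a - b ∣ + ∣ b - c ∣
∣-∣-triangle a b c =
  subst (λ z → ∣ z ∣ ≤ ∣ a - b ∣ + ∣ b - c ∣) (telescope a b c) (ℤP.∣i+j∣≤∣i∣+∣j∣ (a - b) (b - c))
  where
  telescope : ∀ a b c → (a - b) ℤ.+ (b - c) ≡ a - c
  telescope = solve-∀

∣-∣-additive : a ℤ.≤ b → b ℤ.≤ c → ∣ a - c ∣ ≡ ∣ a - b ∣ + ∣ b - c ∣
∣-∣-additive {a} {b} {c} a≤b b≤c = ℤP.+-injective (begin
  + ∣ a - c ∣                  ≡⟨ ℤP.∣-∣-≤ (ℤP.≤-trans a≤b b≤c) ⟩
  c - a                        ≡⟨ telescope a b c ⟩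
  (b - a) ℤ.+ (c - b)          ≡⟨ cong₂ ℤ._+_ (ℤP.∣-∣-≤ a≤b) (ℤP.∣-∣-≤ b≤c) ⟨
  + ∣ a - b ∣ ℤ.+ + ∣ b - c ∣   ∎)
  where
  open ≡-Reasoning
  telescope : ∀ a b c → c - a ≡ (b - a) ℤ.+ (c - b)
  telescope = solve-∀

∣-∣-additive-≥ : a ℤ.≥ b → b ℤ.≥ c → ∣ a - c ∣ ≡ ∣ a - b ∣ + ∣ b - c ∣
∣-∣-additive-≥ {a} {b} {c} b≤a c≤b = begin
  ∣ a - c ∣             ≡⟨ ℤP.∣i-j∣≡∣j-i∣ a c ⟩
  ∣ c - a ∣             ≡⟨ ∣-∣-additive c≤b b≤a ⟩
  ∣ c - b ∣ + ∣ b - a ∣ ≡⟨ cong₂ _+_ (ℤP.∣i-j∣≡∣j-i∣ c b) (ℤP.∣i-j∣≡∣j-i∣ b a) ⟩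
  ∣ b - c ∣ + ∣ a - b ∣ ≡⟨ ℕP.+-comm (∣ b - c ∣) (∣ a - b ∣) ⟩
  ∣ a - b ∣ + ∣ b - c ∣ ∎
  where open ≡-Reasoning

∣-∣≡0⇒≡ : ∣ a - b ∣ ≡ 0 → a ≡ b
∣-∣≡0⇒≡ {a} {b} e = ℤP.i-j≡0⇒i≡j a b (ℤP.∣i∣≡0⇒i≡0 e)

∣i-i∣≡0 : ∀ a → ∣ a - a ∣ ≡ 0
∣i-i∣≡0 a = cong ∣_∣ (ℤP.i≡j⇒i-j≡0 {a} refl)

-- If b lay beyond a, going from a to c through b would pass a twice.
between-collapse : ∣ a - b ∣ + ∣ b - c ∣ ≡ ∣ a - c ∣ → ∣ b - c ∣ ≡ ∣ b - a ∣ + ∣ a - c ∣ → a ≡ b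
between-collapse {a} {b} {c} via-b b-via-a = ∣-∣≡0⇒≡ (ℕP.m+n≡0⇒m≡0 ∣ a - b ∣ back-and-forth≡0)
  where
  back-and-forth≡0 : ∣ a - b ∣ + ∣ b - a ∣ ≡ 0
  back-and-forth≡0 = ℕP.+-cancelʳ-≡ ∣ a - c ∣ _ 0 (begin
    ∣ a - b ∣ + ∣ b - a ∣ + ∣ a - c ∣   ≡⟨ ℕP.+-assoc ∣ a - b ∣ _ _ ⟩
    ∣ a - b ∣ + (∣ b - a ∣ + ∣ a - c ∣) ≡⟨ cong (λ z → ∣ a - b ∣ + z) b-via-a ⟨
    ∣ a - b ∣ + ∣ b - c ∣               ≡⟨ via-b ⟩
    ∣ a - c ∣                           ∎)
    where open ≡-Reasoning

between-lower : ∣ a - b ∣ + ∣ b - c ∣ ≡ ∣ a - c ∣ → a ℤ.≤ c → a ℤ.≤ b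
between-lower {a} {b} {c} via-b a≤c with a ℤP.≤? b
... | yes a≤b = a≤b
... | no a≰b =
  contradiction (between-collapse via-b (∣-∣-additive (ℤP.<⇒≤ b<a) a≤c)) (ℤP.<⇒≢ b<a ∘ sym)
  where b<a = ℤP.≰⇒> a≰b

between-upper : ∣ a - b ∣ + ∣ b - c ∣ ≡ ∣ a - c ∣ → c ℤ.≤ a → b ℤ.≤ a
between-upper {a} {b} {c} via-b c≤a with b ℤP.≤? a
... | yes b≤a = b≤a
... | no b≰a =
  contradiction (between-collapse via-b (∣-∣-additive-≥ (ℤP.<⇒≤ a<b) c≤a)) (ℤP.<⇒≢ a<b)
  where a<b = ℤP.≰⇒> b≰a

dir : ℤ → ℤ → ℤ
dir a b with a ℤP.≤? b
... | yes _ = 1ℤ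
... | no _ = -1ℤ

∣dir∣≡1 : ∀ a b → ∣ dir a b ∣ ≡ 1
∣dir∣≡1 a b with a ℤP.≤? b
... | yes _ = refl
... | no _ = refl

dir-aligned : ∀ a b a′ b′ → dir a′ b′ ≡ dir a b ⊎ dir a′ b′ ≡ ℤ.- dir a b
dir-aligned a b a′ b′ with a ℤP.≤? b | a′ ℤP.≤? b′
... | yes _ | yes _ = inj₁ refl
... | no _  | no _  = inj₁ refl
... | yes _ | no _  = inj₂ refl
... | no _  | yes _ = inj₂ refl

dir-reaches : ∀ a b → a ℤ.+ + ∣ a - b ∣ ℤ.* dir a b ≡ b
dir-reaches a b with a ℤP.≤? b
... | yes a≤b = trans (cong (λ z → a ℤ.+ z ℤ.* 1ℤ) (ℤP.∣-∣-≤ a≤b)) (forward a b)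
  where
  forward : ∀ a b → a ℤ.+ (b - a) ℤ.* 1ℤ ≡ b
  forward = solve-∀
... | no a≰b = trans (cong (λ z → a ℤ.+ z ℤ.* -1ℤ) ∣a-b∣≡a-b) (backward a b)
  where
  ∣a-b∣≡a-b : + ∣ a - b ∣ ≡ a - b
  ∣a-b∣≡a-b = trans (cong +_ (ℤP.∣i-j∣≡∣j-i∣ a b)) (ℤP.∣-∣-≤ (ℤP.<⇒≤ (ℤP.≰⇒> a≰b)))
  backward : ∀ a b → a ℤ.+ (a - b) ℤ.* -1ℤ ≡ b
  backward = solve-∀

between-offset : ∣ a - b ∣ + ∣ b - c ∣ ≡ ∣ a - c ∣ → + ∣ a - b ∣ ≡ dir a c ℤ.* (b - a)
between-offset {a} {b} {c} via-b with a ℤP.≤? c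
... | yes a≤c = trans (ℤP.∣-∣-≤ (between-lower via-b a≤c)) (sym (ℤP.*-identityˡ (b - a)))
... | no a≰c = begin
  + ∣ a - b ∣      ≡⟨ cong +_ (ℤP.∣i-j∣≡∣j-i∣ a b) ⟩
  + ∣ b - a ∣      ≡⟨ ℤP.∣-∣-≤ (between-upper via-b (ℤP.<⇒≤ (ℤP.≰⇒> a≰c))) ⟩
  a - b            ≡⟨ flip-sign a b ⟩
  -1ℤ ℤ.* (b - a)  ∎
  where
  open ≡-Reasoning
  flip-sign : ∀ a b → a - b ≡ -1ℤ ℤ.* (b - a)
  flip-sign = solve-∀

InjectiveOn : (A → B) → List A → Set
InjectiveOn f xs = ∀ {x y} → x ∈ xs → y ∈ xs → f x ≡ f y → x ≡ y

pigeonhole : {f : A → B} {xs : List A} {ys : List B} →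
             Unique xs → InjectiveOn f xs → (∀ {x} → x ∈ xs → f x ∈ ys) → length xs ≤ length ys
pigeonhole {xs = []} _ _ _ = z≤n
pigeonhole {f = f} {xs = x ∷ xs} (x∉xs ∷ xs-unique) f-injective f∈ys
  with ys₁ , ys₂ , refl ← ∈-∃++ (f∈ys (here refl)) = begin
  suc (length xs)            ≤⟨ s≤s (pigeonhole xs-unique (λ m m′ → f-injective (there m) (there m′))
                                                   f∈ys₁++ys₂) ⟩
  suc (length (ys₁ ++ ys₂))  ≡⟨ length-++-sucʳ ys₁ (f x) ys₂ ⟨
  length (ys₁ ++ f x ∷ ys₂)  ∎
  where
  open ℕP.≤-Reasoning
  f∈ys₁++ys₂ : ∀ {y} → y ∈ xs → f y ∈ ys₁ ++ ys₂
  f∈ys₁++ys₂ y∈xs with ∈-++⁻ ys₁ (f∈ys (there y∈xs))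
  ... | inj₁ m = ∈-++⁺ˡ m
  ... | inj₂ (there m) = ∈-++⁺ʳ ys₁ m
  ... | inj₂ (here fy≡fx) =
    contradiction (f-injective (here refl) (there y∈xs) (sym fy≡fx)) (All.lookup x∉xs y∈xs)

length-cartesianProductWith : ∀ {C : Set} (f : A → B → C) xs ys →
                              length (cartesianProductWith f xs ys) ≡ length xs * length ys
length-cartesianProductWith f [] ys = refl
length-cartesianProductWith f (x ∷ xs) ys = begin
  length (map (f x) ys ++ cartesianProductWith f xs ys)          ≡⟨ length-++ (map (f x) ys) ⟩
  length (map (f x) ys) + length (cartesianProductWith f xs ys) ≡⟨ cong₂ _+_ (length-map (f x) ys)
                                                                     (length-cartesianProductWith f xs ys) ⟩
  length ys + length xs * length ys                              ∎
  where open ≡-Reasoning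

Unique-resp-⊆ : {xs ys : List A} → xs ⊆ ys → Unique ys → Unique xs
Unique-resp-⊆ [] [] = []
Unique-resp-⊆ (_ ∷ʳ xs⊆ys) (_ ∷ ys-unique) = Unique-resp-⊆ xs⊆ys ys-unique
Unique-resp-⊆ (refl ∷ xs⊆ys) (y∉ys ∷ ys-unique) = All-resp-⊆ xs⊆ys y∉ys ∷ Unique-resp-⊆ xs⊆ys ys-unique

-- The Erdős–Szekeres argument

ChainsBounded : Rel A 0ℓ → ℕ → List A → Set
ChainsBounded R n xs = ∀ {cs} → cs ⊆ xs → Linked R cs → length cs ≤ n

module _ {R : Rel A 0ℓ} (R? : Decidable R) where

  -- height p qs is the length of a longest R-chain p ∷ cs with cs a sublist of qs, p excluded.
  height : A → List A → ℕ
  height p [] = 0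
  height p (q ∷ qs) with R? p q
  ... | yes _ = suc (height q qs) ⊔ height p qs
  ... | no _  = height p qs

  height-chain : ∀ p qs → Σ[ cs ∈ List A ] cs ⊆ qs × Linked R (p ∷ cs) × height p qs ≤ length cs
  height-chain p [] = [] , [] , [-] , z≤n
  height-chain p (q ∷ qs) with R? p q
  ... | no _ with cs , cs⊆qs , chain , h≤ ← height-chain p qs = cs , q ∷ʳ cs⊆qs , chain , h≤
  ... | yes Rpq with ℕP.⊔-sel (suc (height q qs)) (height p qs)
  ...   | inj₁ through-q with cs , cs⊆qs , chain , h≤ ← height-chain q qs =
    q ∷ cs , refl ∷ cs⊆qs , Rpq ∷ chain , subst (_≤ suc (length cs)) (sym through-q) (s≤s h≤)
  ...   | inj₂ avoid-q with cs , cs⊆qs , chain , h≤ ← height-chain p qs =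
    cs , q ∷ʳ cs⊆qs , chain , subst (_≤ length cs) (sym avoid-q) h≤

  height-mono : ∀ p q qs → height p qs ≤ height p (q ∷ qs)
  height-mono p q qs with R? p q
  ... | yes _ = ℕP.m≤n⊔m (suc (height q qs)) (height p qs)
  ... | no _  = ℕP.≤-refl

  height-step : ∀ {p q} qs → R p q → height q qs < height p (q ∷ qs)
  height-step {p} {q} qs Rpq with R? p q
  ... | yes _  = ℕP.m≤m⊔n (suc (height q qs)) (height p qs)
  ... | no ¬Rpq = contradiction Rpq ¬Rpq

  height<bound : ∀ {n p qs} → ChainsBounded R n (p ∷ qs) → height p qs < n
  height<bound {p = p} {qs} bounded with cs , cs⊆qs , chain , h≤ ← height-chain p qs =
    ℕP.≤-<-trans h≤ (bounded (refl ∷ cs⊆qs) chain)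

module ErdősSzekeres {R₁ R₂ : Rel A 0ℓ} (R₁? : Decidable R₁) (R₂? : Decidable R₂) where

  Comparable : A → A → Set
  Comparable p q = R₁ p q ⊎ R₂ p q

  labels : List A → List (ℕ × ℕ)
  labels [] = []
  labels (p ∷ ps) = (height R₁? p ps , height R₂? p ps) ∷ labels ps

  length-labels : ∀ xs → length (labels xs) ≡ length xs
  length-labels [] = refl
  length-labels (p ∷ ps) = cong suc (length-labels ps)

  _◁_ : ℕ × ℕ → ℕ × ℕ → Set
  (i , j) ◁ (i′ , j′) = i < i′ ⊎ j < j′

  ◁⇒≢ : ∀ {l l′} → l ◁ l′ → l′ ≢ l
  ◁⇒≢ (inj₁ i<i′) refl = ℕP.<-irrefl refl i<i′
  ◁⇒≢ (inj₂ j<j′) refl = ℕP.<-irrefl refl j<j′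

  labels-◁ : ∀ {p} ps → All (Comparable p) ps → All (_◁ (height R₁? p ps , height R₂? p ps)) (labels ps)
  labels-◁ [] [] = []
  labels-◁ {p} (q ∷ qs) (p~q ∷ p~qs) =
    Sum.map (height-step R₁? qs) (height-step R₂? qs) p~q ∷
    All.map (Sum.map (λ i< → ℕP.<-≤-trans i< (height-mono R₁? p q qs))
                     (λ j< → ℕP.<-≤-trans j< (height-mono R₂? p q qs)))
            (labels-◁ qs p~qs)

  labels-unique : ∀ {xs} → AllPairs Comparable xs → Unique (labels xs)
  labels-unique [] = []
  labels-unique {p ∷ ps} (p~ps ∷ comparable) = All.map ◁⇒≢ (labels-◁ ps p~ps) ∷ labels-unique comparable

  labels-bounded : ∀ {n} xs → ChainsBounded R₁ n xs → ChainsBounded R₂ n xs →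
                   All (_∈ cartesianProduct (upTo n) (upTo n)) (labels xs)
  labels-bounded [] _ _ = []
  labels-bounded (p ∷ ps) bounded₁ bounded₂ =
    ∈-cartesianProduct⁺ (∈-upTo⁺ (height<bound R₁? bounded₁)) (∈-upTo⁺ (height<bound R₂? bounded₂)) ∷
    labels-bounded ps (bounded₁ ∘ (p ∷ʳ_)) (bounded₂ ∘ (p ∷ʳ_))

  erdős–szekeres : ∀ {n xs} → AllPairs Comparable xs → ChainsBounded R₁ n xs → ChainsBounded R₂ n xs →
                   length xs ≤ n * n
  erdős–szekeres {n} {xs} comparable bounded₁ bounded₂ = begin
    length xs                                        ≡⟨ length-labels xs ⟨
    length (labels xs)                               ≤⟨ pigeonhole (labels-unique comparable) (λ _ _ → id)
                                                          (All.lookup (labels-bounded xs bounded₁ bounded₂)) ⟩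
    length (cartesianProduct (upTo n) (upTo n))      ≡⟨ length-cartesianProductWith _,_ (upTo n) (upTo n) ⟩
    length (upTo n) * length (upTo n)                ≡⟨ cong₂ _*_ (length-upTo n) (length-upTo n) ⟩
    n * n                                            ∎
    where open ℕP.≤-Reasoning

d : V → V → ℕ
d (x , y) (x′ , y′) = ∣ x - x′ ∣ + ∣ y - y′ ∣

d-refl : ∀ u → d u u ≡ 0
d-refl (x , y) = cong₂ _+_ (∣i-i∣≡0 x) (∣i-i∣≡0 y)

d≡0⇒≡ : d u v ≡ 0 → u ≡ v
d≡0⇒≡ {x , y} {x′ , y′} d≡0 =
  cong₂ _,_ (∣-∣≡0⇒≡ (ℕP.m+n≡0⇒m≡0 _ d≡0)) (∣-∣≡0⇒≡ (ℕP.m+n≡0⇒n≡0 _ d≡0))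

d-triangle : ∀ u v w → d u w ≤ d u v + d v w
d-triangle (x , y) (x′ , y′) (x″ , y″) = begin
  ∣ x - x″ ∣ + ∣ y - y″ ∣
    ≤⟨ ℕP.+-mono-≤ (∣-∣-triangle x x′ x″) (∣-∣-triangle y y′ y″) ⟩
  (∣ x - x′ ∣ + ∣ x′ - x″ ∣) + (∣ y - y′ ∣ + ∣ y′ - y″ ∣)
    ≡⟨ interchange (∣ x - x′ ∣) (∣ x′ - x″ ∣) (∣ y - y′ ∣) (∣ y′ - y″ ∣) ⟩
  (∣ x - x′ ∣ + ∣ y - y′ ∣) + (∣ x′ - x″ ∣ + ∣ y′ - y″ ∣)
    ∎
  where open ℕP.≤-Reasoning

Adj⇒d≡1 : Adj u v → d u v ≡ 1
Adj⇒d≡1 {x , _} (inj₁ (refl , ∣y-y′∣≡1)) = cong₂ _+_ (∣i-i∣≡0 x) ∣y-y′∣≡1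
Adj⇒d≡1 {_ , y} (inj₂ (refl , ∣x-x′∣≡1)) = cong₂ _+_ ∣x-x′∣≡1 (∣i-i∣≡0 y)

_++ʷ_ : Walk u v → Walk v w → Walk u w
[ _ ] ++ʷ q = q
(u ∷⟨ u~w ⟩ p) ++ʷ q = u ∷⟨ u~w ⟩ (p ++ʷ q)

len-++ʷ : (p : Walk u v) (q : Walk v w) → len (p ++ʷ q) ≡ len p + len q
len-++ʷ [ _ ] q = refl
len-++ʷ (_ ∷⟨ _ ⟩ p) q = cong suc (len-++ʷ p q)

∈-++ʷ⁺ʳ : ∀ {z} (p : Walk u v) {q : Walk v w} → z ∈ verts q → z ∈ verts (p ++ʷ q)
∈-++ʷ⁺ʳ [ _ ] z∈q = z∈q
∈-++ʷ⁺ʳ (_ ∷⟨ _ ⟩ p) z∈q = there (∈-++ʷ⁺ʳ p z∈q)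

start∈verts : (p : Walk u v) → u ∈ verts p
start∈verts [ _ ] = here refl
start∈verts (_ ∷⟨ _ ⟩ _) = here refl

d≤len : (p : Walk u v) → d u v ≤ len p
d≤len {u} [ _ ] = ℕP.≤-reflexive (d-refl u)
d≤len {u} {v} (_∷⟨_⟩_ u {w} u~w p) = begin
  d u v          ≤⟨ d-triangle u w v ⟩
  d u w + d w v  ≡⟨ cong (_+ d w v) (Adj⇒d≡1 u~w) ⟩
  suc (d w v)    ≤⟨ s≤s (d≤len p) ⟩
  suc (len p)    ∎
  where open ℕP.≤-Reasoning

d-via-start≤len : (p : Walk u v) → d u u + d u v ≤ len p
d-via-start≤len {u} {v} p = subst (λ n → n + d u v ≤ len p) (sym (d-refl u)) (d≤len p)

d-via≤len : ∀ {z} (p : Walk u v) → z ∈ verts p → d u z + d z v ≤ len p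
d-via≤len p@([ _ ])       (here refl) = d-via-start≤len p
d-via≤len p@(_ ∷⟨ _ ⟩ _) (here refl) = d-via-start≤len p
d-via≤len {u} {v} {z} (_∷⟨_⟩_ u {w} u~w p) (there z∈p) = begin
  d u z + d z v          ≤⟨ ℕP.+-monoˡ-≤ (d z v) (d-triangle u w z) ⟩
  d u w + d w z + d z v  ≡⟨ cong (λ n → n + d w z + d z v) (Adj⇒d≡1 u~w) ⟩
  suc (d w z + d z v)    ≤⟨ s≤s (d-via≤len p z∈p) ⟩
  suc (len p)            ∎
  where open ℕP.≤-Reasoning

empty-walk : u ≡ v → Σ[ p ∈ Walk u v ] len p ≡ 0
empty-walk refl = [ _ ] , refl

∣x-[x+δ]∣≡∣δ∣ : ∀ x δ → ∣ x - (x ℤ.+ δ) ∣ ≡ ∣ δ ∣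
∣x-[x+δ]∣≡∣δ∣ x δ = trans (cong ∣_∣ (step x δ)) (ℤP.∣-i∣≡∣i∣ δ)
  where
  step : ∀ x δ → x - (x ℤ.+ δ) ≡ ℤ.- δ
  step = solve-∀

shift-suc : ∀ x δ n → x ℤ.+ (1ℤ ℤ.+ n) ℤ.* δ ≡ (x ℤ.+ δ) ℤ.+ n ℤ.* δ
shift-suc = solve-∀

ray-x : ∀ {δ} → ∣ δ ∣ ≡ 1 → ∀ n {x x′} y → x′ ≡ x ℤ.+ + n ℤ.* δ →
        Σ[ p ∈ Walk (x , y) (x′ , y) ] len p ≡ n
ray-x _ zero {x} y x′≡x = empty-walk (cong (_, y) (sym (trans x′≡x (ℤP.+-identityʳ x))))
ray-x {δ} ∣δ∣≡1 (suc n) {x} y x′≡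
  with p , len-p ← ray-x ∣δ∣≡1 n y (trans x′≡ (shift-suc x δ (+ n))) =
  (x , y) ∷⟨ inj₂ (refl , trans (∣x-[x+δ]∣≡∣δ∣ x δ) ∣δ∣≡1) ⟩ p , cong suc len-p

ray-y : ∀ {δ} → ∣ δ ∣ ≡ 1 → ∀ n x {y y′} → y′ ≡ y ℤ.+ + n ℤ.* δ →
        Σ[ p ∈ Walk (x , y) (x , y′) ] len p ≡ n
ray-y _ zero x {y} y′≡y = empty-walk (cong (x ,_) (sym (trans y′≡y (ℤP.+-identityʳ y))))
ray-y {δ} ∣δ∣≡1 (suc n) x {y} y′≡
  with p , len-p ← ray-y ∣δ∣≡1 n x (trans y′≡ (shift-suc y δ (+ n))) =
  (x , y) ∷⟨ inj₁ (refl , trans (∣x-[x+δ]∣≡∣δ∣ y δ) ∣δ∣≡1) ⟩ p , cong suc len-p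

shortest-walk : ∀ u v → Σ[ p ∈ Walk u v ] len p ≡ d u v
shortest-walk (x , y) (x′ , y′)
  with p , len-p ← ray-x (∣dir∣≡1 x x′) ∣ x - x′ ∣ y (sym (dir-reaches x x′))
     | q , len-q ← ray-y (∣dir∣≡1 y y′) ∣ y - y′ ∣ x′ (sym (dir-reaches y y′)) =
  p ++ʷ q , trans (len-++ʷ p q) (cong₂ _+_ len-p len-q)

geodesic⇒len≡d : (p : Walk u v) → IsGeodesic p → len p ≡ d u v
geodesic⇒len≡d {u} {v} p p-shortest with q , len-q ← shortest-walk u v =
  ℕP.≤-antisym (subst (len p ≤_) len-q (p-shortest q)) (d≤len p)

len≡d⇒geodesic : (p : Walk u v) → len p ≡ d u v → IsGeodesic p
len≡d⇒geodesic p len≡d q = subst (_≤ len q) (sym len≡d) (d≤len q)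

geodesic-via : ∀ {z} (p : Walk u v) → len p ≡ d u v → z ∈ verts p → d u z + d z v ≡ d u v
geodesic-via {u} {v} {z} p len≡d z∈p =
  ℕP.≤-antisym (subst (d u z + d z v ≤_) len≡d (d-via≤len p z∈p)) (d-triangle u z v)

geodesic-d-injective : (p : Walk u v) → len p ≡ d u v → InjectiveOn (d u) (verts p)
geodesic-d-injective [ _ ] _ (here refl) (here refl) _ = refl
geodesic-d-injective (_ ∷⟨ _ ⟩ _) _ (here refl) (here refl) _ = refl
geodesic-d-injective {u} (_ ∷⟨ _ ⟩ _) _ (here refl) (there _) duu≡duz =
  d≡0⇒≡ (trans (sym duu≡duz) (d-refl u))
geodesic-d-injective {u} (_ ∷⟨ _ ⟩ _) _ (there _) (here refl) duz≡duu =
  sym (d≡0⇒≡ (trans duz≡duu (d-refl u)))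
geodesic-d-injective {u} {v} (_∷⟨_⟩_ u {w} u~w q) len≡d (there z∈q) (there z′∈q) duz≡duz′ =
  geodesic-d-injective q q-geodesic z∈q z′∈q
    (ℕP.suc-injective (trans (sym (d-u≡suc-d-w z∈q)) (trans duz≡duz′ (d-u≡suc-d-w z′∈q))))
  where
  q-geodesic : len q ≡ d w v
  q-geodesic = ℕP.≤-antisym (ℕP.≤-pred (begin
    suc (len q)    ≡⟨ len≡d ⟩
    d u v          ≤⟨ d-triangle u w v ⟩
    d u w + d w v  ≡⟨ cong (_+ d w v) (Adj⇒d≡1 u~w) ⟩
    suc (d w v)    ∎)) (d≤len q)
    where open ℕP.≤-Reasoning
  d-u≡suc-d-w : ∀ {y} → y ∈ verts q → d u y ≡ suc (d w y)
  d-u≡suc-d-w {y} y∈q = ℕP.+-cancelʳ-≡ (d y v) _ _ (begin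
    d u y + d y v          ≡⟨ geodesic-via (u ∷⟨ u~w ⟩ q) len≡d (there y∈q) ⟩
    d u v                  ≡⟨ len≡d ⟨
    suc (len q)            ≡⟨ cong suc q-geodesic ⟩
    suc (d w v)            ≡⟨ cong suc (geodesic-via q q-geodesic y∈q) ⟨
    suc (d w y + d y v)    ∎)
    where open ≡-Reasoning

-- Along a geodesic both coordinates are monotone

+-tight : ∀ {m m′ n n′} → n ≤ m → n′ ≤ m′ → m + m′ ≡ n + n′ → m ≡ n × m′ ≡ n′
+-tight {m} {m′} {n} {n′} n≤m n′≤m′ sum≡ =
  m≡n , ℕP.+-cancelˡ-≡ n m′ n′ (subst (λ k → k + m′ ≡ n + n′) m≡n sum≡)
  where
  m≡n : m ≡ n
  m≡n = ℕP.≤-antisym (ℕP.+-cancelʳ-≤ n′ m n (ℕP.≤-trans (ℕP.+-monoʳ-≤ m n′≤m′) (ℕP.≤-reflexive sum≡)))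
                      n≤m

geodesic-offset : ∀ {x₀ y₀ x₁ y₁ x y} (p : Walk (x₀ , y₀) (x₁ , y₁)) → len p ≡ d (x₀ , y₀) (x₁ , y₁) →
                  (x , y) ∈ verts p →
                  + d (x₀ , y₀) (x , y) ≡ dir x₀ x₁ ℤ.* (x - x₀) ℤ.+ dir y₀ y₁ ℤ.* (y - y₀)
geodesic-offset {x₀} {y₀} {x₁} {y₁} {x} {y} p len≡d z∈p = begin
  + (∣ x₀ - x ∣ + ∣ y₀ - y ∣)
    ≡⟨ ℤP.pos-+ ∣ x₀ - x ∣ ∣ y₀ - y ∣ ⟩
  + ∣ x₀ - x ∣ ℤ.+ + ∣ y₀ - y ∣
    ≡⟨ cong₂ ℤ._+_ (between-offset {x₀} {x} {x₁} via-x) (between-offset {y₀} {y} {y₁} via-y) ⟩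
  dir x₀ x₁ ℤ.* (x - x₀) ℤ.+ dir y₀ y₁ ℤ.* (y - y₀)
    ∎
  where
  open ≡-Reasoning
  tight = +-tight (∣-∣-triangle x₀ x x₁) (∣-∣-triangle y₀ y y₁) (begin
    (∣ x₀ - x ∣ + ∣ x - x₁ ∣) + (∣ y₀ - y ∣ + ∣ y - y₁ ∣)
      ≡⟨ interchange (∣ x₀ - x ∣) (∣ y₀ - y ∣) (∣ x - x₁ ∣) (∣ y - y₁ ∣) ⟨
    (∣ x₀ - x ∣ + ∣ y₀ - y ∣) + (∣ x - x₁ ∣ + ∣ y - y₁ ∣)
      ≡⟨ geodesic-via p len≡d z∈p ⟩
    ∣ x₀ - x₁ ∣ + ∣ y₀ - y₁ ∣
      ∎)
  via-x = proj₁ tight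
  via-y = proj₂ tight

sum-coord diff-coord : V → ℤ
sum-coord (x , y) = x ℤ.+ y
diff-coord (x , y) = x - y

geodesic-sum-or-diff-injective : (p : Walk u v) → IsGeodesic p →
                                 InjectiveOn sum-coord (verts p) ⊎ InjectiveOn diff-coord (verts p)
geodesic-sum-or-diff-injective {x₀ , y₀} {x₁ , y₁} p p-geodesic =
  Sum.map (λ same → determined-by sum-coord (λ s → εx ℤ.* (s - (x₀ ℤ.+ y₀)))
                      (λ x y → trans (cong (λ ε → εx ℤ.* (x - x₀) ℤ.+ ε ℤ.* (y - y₀)) same)
                                     (same-direction εx x y x₀ y₀)))
          (λ opposite → determined-by diff-coord (λ t → εx ℤ.* (t - (x₀ - y₀)))
                          (λ x y → trans (cong (λ ε → εx ℤ.* (x - x₀) ℤ.+ ε ℤ.* (y - y₀)) opposite)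
                                         (opposite-direction εx x y x₀ y₀)))
          (dir-aligned x₀ x₁ y₀ y₁)
  where
  εx = dir x₀ x₁
  εy = dir y₀ y₁
  len≡d = geodesic⇒len≡d p p-geodesic

  same-direction : ∀ ε x y x₀ y₀ → ε ℤ.* (x - x₀) ℤ.+ ε ℤ.* (y - y₀) ≡ ε ℤ.* ((x ℤ.+ y) - (x₀ ℤ.+ y₀))
  same-direction = solve-∀
  opposite-direction : ∀ ε x y x₀ y₀ → ε ℤ.* (x - x₀) ℤ.+ (ℤ.- ε) ℤ.* (y - y₀) ≡ ε ℤ.* ((x - y) - (x₀ - y₀))
  opposite-direction = solve-∀

  determined-by : (f : V → ℤ) (F : ℤ → ℤ) →
                  (∀ x y → εx ℤ.* (x - x₀) ℤ.+ εy ℤ.* (y - y₀) ≡ F (f (x , y))) → InjectiveOn f (verts p)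
  determined-by f F offset≡ {x , y} {x′ , y′} z∈p z′∈p fz≡fz′ = geodesic-d-injective p len≡d z∈p z′∈p
    (ℤP.+-injective (begin
      + d (x₀ , y₀) (x , y)      ≡⟨ geodesic-offset p len≡d z∈p ⟩
      _                          ≡⟨ offset≡ x y ⟩
      F (f (x , y))              ≡⟨ cong F fz≡fz′ ⟩
      F (f (x′ , y′))            ≡⟨ offset≡ x′ y′ ⟨
      _                          ≡⟨ geodesic-offset p len≡d z′∈p ⟨
      + d (x₀ , y₀) (x′ , y′)    ∎))
    where open ≡-Reasoning

-- The lower bound: a rotated square grid

rotated : ℕ → ℕ → V
rotated a b = (+ a ℤ.+ + b , + a - + b)

rotated-grid : ℕ → List V
rotated-grid n = cartesianProductWith rotated (upTo n) (upTo n)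

doubles : ℕ → List ℤ
doubles n = map (λ a → + a ℤ.+ + a) (upTo n)

sum-rotated : ∀ a b → sum-coord (rotated a b) ≡ + a ℤ.+ + a
sum-rotated a b = sum-identity (+ a) (+ b)
  where
  sum-identity : ∀ a b → (a ℤ.+ b) ℤ.+ (a - b) ≡ a ℤ.+ a
  sum-identity = solve-∀

diff-rotated : ∀ a b → diff-coord (rotated a b) ≡ + b ℤ.+ + b
diff-rotated a b = diff-identity (+ a) (+ b)
  where
  diff-identity : ∀ a b → (a ℤ.+ b) - (a - b) ≡ b ℤ.+ b
  diff-identity = solve-∀

double-injective : ∀ {a a′} → + a ℤ.+ + a ≡ + a′ ℤ.+ + a′ → a ≡ a′
double-injective {a} {a′} 2a≡2a′ = ℕP.*-cancelˡ-≡ a a′ 2 (begin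
  2 * a    ≡⟨ cong (_+_ a) (ℕP.+-identityʳ a) ⟩
  a + a    ≡⟨ ℤP.+-injective 2a≡2a′ ⟩
  a′ + a′  ≡⟨ cong (_+_ a′) (ℕP.+-identityʳ a′) ⟨
  2 * a′   ∎)
  where open ≡-Reasoning

rotated-injective : ∀ {a a′ b b′} → rotated a b ≡ rotated a′ b′ → a ≡ a′ × b ≡ b′
rotated-injective {a} {a′} {b} {b′} eq =
  double-injective (trans (sym (sum-rotated a b)) (trans (cong sum-coord eq) (sum-rotated a′ b′))) ,
  double-injective (trans (sym (diff-rotated a b)) (trans (cong diff-coord eq) (diff-rotated a′ b′)))

rotated-grid-unique : ∀ n → Unique (rotated-grid n)
rotated-grid-unique n = cartesianProductWith⁺ rotated rotated-injective (upTo⁺ n) (upTo⁺ n)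

length-rotated-grid : ∀ n → length (rotated-grid n) ≡ n * n
length-rotated-grid n = trans (length-cartesianProductWith rotated (upTo n) (upTo n))
                              (cong₂ _*_ (length-upTo n) (length-upTo n))

module _ {n : ℕ} {z : V} (z∈grid : z ∈ rotated-grid n) where

  sum∈doubles : sum-coord z ∈ doubles n
  sum∈doubles with a , b , a∈ , _ , refl ← ∈-cartesianProductWith⁻ rotated (upTo n) (upTo n) z∈grid =
    subst (_∈ doubles n) (sym (sum-rotated a b)) (∈-map⁺ _ a∈)

  diff∈doubles : diff-coord z ∈ doubles n
  diff∈doubles with a , b , _ , b∈ , refl ← ∈-cartesianProductWith⁻ rotated (upTo n) (upTo n) z∈grid =
    subst (_∈ doubles n) (sym (diff-rotated a b)) (∈-map⁺ _ b∈)

rotated-grid-gp : ∀ n → IsGPk (suc n) (_∈ rotated-grid n)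
rotated-grid-gp n u v p p-geodesic (cs , cs-unique , cs-on-p , n<|cs|) =
  ℕP.<⇒≱ n<|cs| (Sum.[ count sum-coord sum∈doubles , count diff-coord diff∈doubles ]
                      (geodesic-sum-or-diff-injective p p-geodesic))
  where
  count : (f : V → ℤ) → (∀ {z} → z ∈ rotated-grid n → f z ∈ doubles n) → InjectiveOn f (verts p) →
          length cs ≤ n
  count f f∈doubles f-injective = begin
    length cs         ≤⟨ pigeonhole cs-unique (λ c∈cs c′∈cs → f-injective (on-p c∈cs) (on-p c′∈cs))
                           (f∈doubles ∘ in-grid) ⟩
    length (doubles n) ≡⟨ trans (length-map _ (upTo n)) (length-upTo n) ⟩
    n                 ∎
    where
    open ℕP.≤-Reasoning
    in-grid : ∀ {c} → c ∈ cs → c ∈ rotated-grid n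
    in-grid = proj₁ ∘ All.lookup cs-on-p
    on-p : ∀ {c} → c ∈ cs → c ∈ verts p
    on-p = proj₂ ∘ All.lookup cs-on-p

-- The upper bound: monotone chains lie on geodesics

module Monotone {_≼_ : Rel ℤ 0ℓ} (_≼?_ : Decidable _≼_) (≼-refl : Reflexive _≼_) (≼-trans : Transitive _≼_)
                (≼-additive : ∀ {a b c} → a ≼ b → b ≼ c → ∣ a - c ∣ ≡ ∣ a - b ∣ + ∣ b - c ∣) where

  _⊑_ : Rel V 0ℓ
  u ⊑ v = proj₁ u ℤ.≤ proj₁ v × proj₂ u ≼ proj₂ v

  _⊑?_ : Decidable _⊑_
  u ⊑? v = (proj₁ u ℤP.≤? proj₁ v) ×-dec (proj₂ u ≼? proj₂ v)

  ⊑-additive : ∀ {u v w} → u ⊑ v → v ⊑ w → d u w ≡ d u v + d v w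
  ⊑-additive {x , y} {x′ , y′} {x″ , y″} (x≤x′ , y≼y′) (x′≤x″ , y′≼y″) =
    trans (cong₂ _+_ (∣-∣-additive x≤x′ x′≤x″) (≼-additive y≼y′ y′≼y″))
          (interchange (∣ x - x′ ∣) (∣ x′ - x″ ∣) (∣ y - y′ ∣) (∣ y′ - y″ ∣))

  chain-walk : ∀ {c cs} → Linked _⊑_ (c ∷ cs) →
               Σ[ v ∈ V ] Σ[ p ∈ Walk c v ] len p ≡ d c v × c ⊑ v × All (_∈ verts p) (c ∷ cs)
  chain-walk {c} [-] = c , [ c ] , sym (d-refl c) , (ℤP.≤-refl , ≼-refl) , here refl ∷ []
  chain-walk {c} (_∷_ {y = b} c⊑b b-chain)
    with v , p , len-p , b⊑v , b-chain-on-p ← chain-walk b-chain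
       | q , len-q ← shortest-walk c b =
    v , q ++ʷ p , len-q++p , (ℤP.≤-trans (proj₁ c⊑b) (proj₁ b⊑v) , ≼-trans (proj₂ c⊑b) (proj₂ b⊑v)) ,
    start∈verts (q ++ʷ p) ∷ All.map (∈-++ʷ⁺ʳ q) b-chain-on-p
    where
    len-q++p : len (q ++ʷ p) ≡ d c v
    len-q++p = trans (len-++ʷ q p) (trans (cong₂ _+_ len-q len-p) (sym (⊑-additive c⊑b b⊑v)))

  gp-chains-bounded : ∀ {n S xs} → IsGPk (suc n) S → Unique xs → All S xs → ChainsBounded _⊑_ n xs
  gp-chains-bounded _ _ _ {[]} _ _ = z≤n
  gp-chains-bounded gp xs-unique xs-in-S {c ∷ cs} cs⊆xs chain
    with v , p , len-p , _ , chain-on-p ← chain-walk chain =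
    ℕP.≮⇒≥ λ n<|cs| → gp c v p (len≡d⇒geodesic p len-p)
      (c ∷ cs , Unique-resp-⊆ cs⊆xs xs-unique , All.zip (All-resp-⊆ cs⊆xs xs-in-S , chain-on-p) , n<|cs|)

module NE = Monotone ℤP._≤?_ ℤP.≤-refl ℤP.≤-trans ∣-∣-additive
module SE = Monotone (flip ℤP._≤?_) ℤP.≤-refl (flip ℤP.≤-trans) ∣-∣-additive-≥

gp-upper : ∀ n (S : V → Set) → IsGPk (suc n) S → (L : List V) → Unique L → All S L → length L ≤ n * n
gp-upper n S gp L L-unique L-in-S = begin
  length L         ≡⟨ ↭-length (sort-↭ L) ⟨
  length (sort L)  ≤⟨ erdős–szekeres comparable (NE.gp-chains-bounded gp sorted-unique sorted-in-S)
                                                (SE.gp-chains-bounded gp sorted-unique sorted-in-S) ⟩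
  n * n            ∎
  where
  open ℕP.≤-Reasoning
  open ErdősSzekeres NE._⊑?_ SE._⊑?_
  sorted-unique : Unique (sort L)
  sorted-unique = Unique-resp-↭ (↭⇒↭ₛ (↭-sym (sort-↭ L))) L-unique
  sorted-in-S : All S (sort L)
  sorted-in-S = All-resp-↭ (↭-sym (sort-↭ L)) L-in-S
  comparable : AllPairs Comparable (sort L)
  comparable = AllPairs.map (λ x≤x′ → Sum.map (x≤x′ ,_) (x≤x′ ,_) (ℤP.≤-total _ _))
                            (Linked⇒AllPairs ℤP.≤-trans (sort-↗ L))

gpk-equals : ∀ n → GpkEquals (suc n) (n * n)
gpk-equals n = (rotated-grid n , rotated-grid-unique n , length-rotated-grid n , rotated-grid-gp n) , gp-upper n

corollary5p7 : (k : ℕ) → 2 ≤ k → GpkEquals k ((k ∸ 1) ^ 2)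
corollary5p7 zero ()
corollary5p7 (suc n) _ = subst (GpkEquals (suc n)) (cong (n *_) (sym (ℕP.*-identityʳ n))) (gpk-equals n)
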